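{- For every connected undirected simple graph $G$, the period of the asynchronous maximum model on $G$ is $1$; that is, every absorbing component of the Markov chain of possibilities of $G$ consists of exactly one valuation (and this valuation is a constant valuation).
   Context: Let $G=(V,E)$ be a finite simple undirected graph with $n=|V|$ vertices and $[n]=\{1,\dots,n\}$. A valuation is a function $f:V\to[n]$; it is constant if it takes the same value at every vertex. The asynchronous maximum model: given the current valuation $f_t$, choose $v'\in V$ uniformly at random; set $f_{t+1}(v')=\max\{f_t(u): u\neq v' \text{ adjacent to } v'\}$ (unchanged if $v'$ has no neighbour), and $f_{t+1}(v)=f_t(v)$ for $v\neq v'$. The Markov chain of possibilities is the directed graph (loops allowed) whose vertices are all valuations $V\to[n]$, with an edge $f\to g$ whenever the one-round transition probability from $f$ to $g$ is positive. Its absorbing components are the maximal strongly connected components with no edge leaving them. The period of $G$ is the maximum number of valuations in an absorbing component. -}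

module Defs where

open import Data.Nat using (ℕ)
open import Data.Nat.Base using (_≤ᵇ_)
open import Data.Fin using (Fin; toℕ; _≟_)
open import Data.Bool using (Bool; true; false; if_then_else_)
open import Data.Maybe using (Maybe; just; nothing)
open import Data.List using (List; foldr; allFin)
open import Data.Product using (Σ; ∃; _×_; _,_)
open import Relation.Binary.PropositionalEquality using (_≡_; _≢_)
open import Relation.Nullary using (¬_; yes; no)

record SimpleGraph (n : ℕ) : Set where
  field
    adj    : Fin n → Fin n → Bool
    sym    : ∀ u v → adj u v ≡ adj v u
    irrefl : ∀ v → adj v v ≡ false
open SimpleGraph public

data Path {n : ℕ} (G : SimpleGraph n) : Fin n → Fin n → Set where
  stop : ∀ {v} → Path G v v
  edge : ∀ {u w v} → adj G u w ≡ true → Path G w v → Path G u v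

Connected : ∀ {n} → SimpleGraph n → Set
Connected {n} G = ∀ (u v : Fin n) → Path G u v

-- Valuations V → [n]; the value set [n] = {1,…,n} is represented by Fin n
-- (order preserving: i ↦ toℕ i + 1).
Valuation : ℕ → Set
Valuation n = Fin n → Fin n

_≈_ : ∀ {n} → Valuation n → Valuation n → Set
f ≈ g = ∀ v → f v ≡ g v

IsConstant : ∀ {n} → Valuation n → Set
IsConstant {n} f = ∀ (u v : Fin n) → f u ≡ f v

maxFin : ∀ {n} → Fin n → Fin n → Fin n
maxFin a b = if toℕ a ≤ᵇ toℕ b then b else a

maxMaybe : ∀ {n} → Fin n → Maybe (Fin n) → Maybe (Fin n)
maxMaybe a nothing  = just a
maxMaybe a (just b) = just (maxFin a b)

nbMax : ∀ {n} → SimpleGraph n → Valuation n → Fin n → Maybe (Fin n)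
nbMax {n} G f v =
  foldr (λ u acc → if adj G v u then maxMaybe (f u) acc else acc) nothing (allFin n)

update : ∀ {n} → SimpleGraph n → Valuation n → Fin n → Valuation n
update G f v w with v ≟ w
... | no _ = f w
... | yes _ with nbMax G f v
...   | nothing = f w
...   | just m  = m

-- Edge f → g of the Markov chain of possibilities: the transition has
-- positive probability iff g arises from f by updating some vertex v
-- (each vertex is chosen with probability 1/n > 0).
Step : ∀ {n} → SimpleGraph n → Valuation n → Valuation n → Set
Step {n} G f g = Σ (Fin n) λ v → g ≈ update G f v

data Reach {n : ℕ} (G : SimpleGraph n) : Valuation n → Valuation n → Set where
  here : ∀ {f g} → f ≈ g → Reach G f g
  step : ∀ {f h g} → Step G f h → Reach G h g → Reach G f g

record AbsorbingComponent {n : ℕ} (G : SimpleGraph n) (C : Valuation n → Set) : Set where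
  field
    nonempty  : Σ (Valuation n) C
    strongly  : ∀ f g → C f → C g → Reach G f g
    maximal   : ∀ f g → C f → Reach G f g → Reach G g f → C g
    closed    : ∀ f g → C f → Step G f g → C g

-- Take f in the absorbing component C and a vertex v₀ where f is maximal, say f v₀ = M.
-- An update only copies values already present, so M stays the largest value, and a
-- vertex adjacent to a vertex carrying M takes the value M when updated.  Walking along
-- paths from v₀ therefore reaches the constant valuation M, which lies in C because C is
-- closed.  From a constant valuation every update is the identity, so by strong
-- connectivity C contains nothing else.
module Submission where

open import Defs hiding (sym)
open import Defs using () renaming (sym to adj-sym)
open import Data.Nat using (ℕ; zero; suc; _≤_; _≤ᵇ_)
open import Data.Nat.Properties using (≤-refl; ≤-trans; ≤-antisym; ≤-total; ≰⇒≥; ≤ᵇ-reflects-≤)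
open import Data.Fin as Fin using (Fin; toℕ; _≟_)
open import Data.Fin.Properties using (toℕ-injective)
open import Data.Bool using (true; false; if_then_else_)
open import Data.Maybe using (Maybe; just; nothing)
open import Data.Maybe.Properties using (just-injective)
open import Data.List using (List; []; _∷_; foldr; allFin)
open import Data.List.Membership.Propositional using (_∈_)
open import Data.List.Membership.Propositional.Properties using (∈-allFin)
open import Data.List.Relation.Unary.Any using (here; there)
open import Data.Product using (Σ; ∃; _×_; _,_)
open import Data.Empty using (⊥-elim)
open import Data.Sum using (_⊎_; inj₁; inj₂)
open import Relation.Binary.PropositionalEquality using (_≡_; refl; sym; trans; subst)
open import Relation.Nullary using (¬_; yes; no; ofʸ; ofⁿ)

maxFin-≤ˡ : ∀ {n} (a b : Fin n) → toℕ a ≤ toℕ (maxFin a b)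
maxFin-≤ˡ a b with toℕ a ≤ᵇ toℕ b | ≤ᵇ-reflects-≤ (toℕ a) (toℕ b)
... | true  | ofʸ a≤b = a≤b
... | false | ofⁿ _   = ≤-refl

maxFin-≤ʳ : ∀ {n} (a b : Fin n) → toℕ b ≤ toℕ (maxFin a b)
maxFin-≤ʳ a b with toℕ a ≤ᵇ toℕ b | ≤ᵇ-reflects-≤ (toℕ a) (toℕ b)
... | true  | ofʸ _   = ≤-refl
... | false | ofⁿ a≰b = ≰⇒≥ a≰b

maxFin-sel : ∀ {n} (a b : Fin n) → maxFin a b ≡ a ⊎ maxFin a b ≡ b
maxFin-sel a b with toℕ a ≤ᵇ toℕ b
... | true  = inj₂ refl
... | false = inj₁ refl

argmax : ∀ {n} (f : Valuation n) → Fin n → (xs : List (Fin n)) →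
         ∃ λ v → ∀ {x} → x ∈ xs → toℕ (f x) ≤ toℕ (f v)
argmax f x₀ [] = x₀ , λ ()
argmax f x₀ (y ∷ ys) with argmax f x₀ ys
... | v , ys≤v with ≤-total (toℕ (f y)) (toℕ (f v))
...   | inj₁ y≤v = v , λ { (here refl) → y≤v ; (there x∈ys) → ys≤v x∈ys }
...   | inj₂ v≤y = y , λ { (here refl) → ≤-refl ; (there x∈ys) → ≤-trans (ys≤v x∈ys) v≤y }

module _ {n : ℕ} (G : SimpleGraph n) (f : Valuation n) (v : Fin n) where

  neighbourMax : List (Fin n) → Maybe (Fin n)
  neighbourMax = foldr (λ u acc → if adj G v u then maxMaybe (f u) acc else acc) nothing

  neighbourMax-attained : ∀ us {m} → neighbourMax us ≡ just m → ∃ λ u → f u ≡ m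
  neighbourMax-attained (u ∷ us) eq with adj G v u
  ... | false = neighbourMax-attained us eq
  ... | true with neighbourMax us in rest
  ...   | nothing = u , just-injective eq
  ...   | just b with maxFin-sel (f u) b | eq
  ...     | inj₁ max≡fu | refl = u , sym max≡fu
  ...     | inj₂ max≡b  | refl with neighbourMax-attained us rest
  ...       | w , fw≡b = w , trans fw≡b (sym max≡b)

  neighbourMax-≥ : ∀ us {u} → u ∈ us → adj G v u ≡ true →
                   ∃ λ m → neighbourMax us ≡ just m × toℕ (f u) ≤ toℕ m
  neighbourMax-≥ (u ∷ us) (here refl) vu rewrite vu with neighbourMax us
  ... | nothing = f u , refl , ≤-refl
  ... | just b  = maxFin (f u) b , refl , maxFin-≤ˡ (f u) b
  neighbourMax-≥ (x ∷ us) (there u∈us) vu with neighbourMax-≥ us u∈us vu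
  ... | m , eq , fu≤m with adj G v x
  ...   | false = m , eq , fu≤m
  ...   | true rewrite eq = maxFin (f x) m , refl , ≤-trans fu≤m (maxFin-≤ʳ (f x) m)

neighbourMax-cong : ∀ {n} (G : SimpleGraph n) {f g : Valuation n} v → f ≈ g →
                    ∀ us → neighbourMax G f v us ≡ neighbourMax G g v us
neighbourMax-cong G v f≈g [] = refl
neighbourMax-cong G v f≈g (u ∷ us) rewrite neighbourMax-cong G v f≈g us | f≈g u = refl

module _ {n : ℕ} (G : SimpleGraph n) where

  adj-flip : ∀ {u v} → adj G u v ≡ true → adj G v u ≡ true
  adj-flip {u} {v} uv = trans (adj-sym G v u) uv

  update-≢ : ∀ f {v w} → ¬ v ≡ w → update G f v w ≡ f w
  update-≢ f {v} {w} v≢w with v ≟ w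
  ... | yes v≡w = ⊥-elim (v≢w v≡w)
  ... | no _    = refl

  update-self : ∀ f v {m} → nbMax G f v ≡ just m → update G f v v ≡ m
  update-self f v eq with v ≟ v
  ... | no v≢v = ⊥-elim (v≢v refl)
  ... | yes _ rewrite eq = refl

  update-attained : ∀ f v w → ∃ λ u → update G f v w ≡ f u
  update-attained f v w with v ≟ w
  ... | no _ = w , refl
  ... | yes _ with nbMax G f v in eq
  ...   | nothing = w , refl
  ...   | just m with neighbourMax-attained G f v (allFin n) eq
  ...     | u , fu≡m = u , sym fu≡m

  update-cong : ∀ {f g} v → f ≈ g → update G f v ≈ update G g v
  update-cong {f} {g} v f≈g w with v ≟ w
  ... | no _ = f≈g w
  ... | yes _ with nbMax G f v | nbMax G g v | neighbourMax-cong G v f≈g (allFin n)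
  ...   | nothing | .nothing | refl = f≈g w
  ...   | just m  | .(just m) | refl = refl

  Reach-trans : ∀ {f g h} → Reach G f g → Reach G g h → Reach G f h
  Reach-trans (here f≈g) (here g≈h) = here λ x → trans (f≈g x) (g≈h x)
  Reach-trans (here f≈g) (step (v , s) r) =
    step (v , λ x → trans (s x) (sym (update-cong v f≈g x))) r
  Reach-trans (step s r) r′ = step s (Reach-trans r r′)

  Reach-attained : ∀ {f h} → Reach G f h → ∀ x → ∃ λ u → h x ≡ f u
  Reach-attained (here f≈h) x = x , sym (f≈h x)
  Reach-attained {f} (step (v , s) r) x with Reach-attained r x
  ... | u , hx≡gu with update-attained f v u
  ...   | w , eq = w , trans hx≡gu (trans (s u) eq)

  Reach-constant : ∀ {f h} → IsConstant f → Reach G f h → ∀ x y → h x ≡ f y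
  Reach-constant const r x y with Reach-attained r x
  ... | u , hx≡fu = trans hx≡fu (const u y)

module _ {n : ℕ} {G : SimpleGraph n} {C : Valuation n → Set} (A : AbsorbingComponent G C) where
  open AbsorbingComponent A

  AbsorbingComponent-reach : ∀ {f g} → C f → Reach G f g → C g
  AbsorbingComponent-reach {f} {g} Cf (here f≈g) =
    maximal f g Cf (here f≈g) (here λ x → sym (f≈g x))
  AbsorbingComponent-reach {f} Cf (step {h = h} s r) =
    AbsorbingComponent-reach (closed f h Cf s) r

  AbsorbingComponent-≈ : ∀ {f g} → C f → f ≈ g → C g
  AbsorbingComponent-≈ Cf f≈g = AbsorbingComponent-reach Cf (here f≈g)

module Spread {n : ℕ} (G : SimpleGraph n) (M : Fin n) where

  BoundedBy : Valuation n → Set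
  BoundedBy f = ∀ x → toℕ (f x) ≤ toℕ M

  Reach-bounded : ∀ {f h} → Reach G f h → BoundedBy f → BoundedBy h
  Reach-bounded r bf x with Reach-attained G r x
  ... | u , hx≡fu rewrite hx≡fu = bf u

  ReachKeeping : Valuation n → Valuation n → Set
  ReachKeeping f h = Reach G f h × (∀ x → f x ≡ M → h x ≡ M)

  ReachKeeping-refl : ∀ f → ReachKeeping f f
  ReachKeeping-refl f = here (λ _ → refl) , λ _ fx → fx

  ReachKeeping-trans : ∀ {f g h} → ReachKeeping f g → ReachKeeping g h → ReachKeeping f h
  ReachKeeping-trans (r , keep) (r′ , keep′) = Reach-trans G r r′ , λ x fx → keep′ x (keep x fx)

  update-next-to-max : ∀ {f u w} → BoundedBy f → f u ≡ M → adj G w u ≡ true →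
                       update G f w w ≡ M
  update-next-to-max {f} {u} {w} bf fu≡M wu with neighbourMax-≥ G f w (allFin n) (∈-allFin u) wu
  ... | m , eq , fu≤m with neighbourMax-attained G f w (allFin n) eq
  ...   | u′ , fu′≡m = trans (update-self G f w eq) (toℕ-injective (≤-antisym m≤M M≤m))
    where
      m≤M : toℕ m ≤ toℕ M
      m≤M = subst (λ z → toℕ z ≤ toℕ M) fu′≡m (bf u′)
      M≤m : toℕ M ≤ toℕ m
      M≤m = subst (λ z → toℕ z ≤ toℕ m) fu≡M fu≤m

  update-keeping : ∀ {f u w} → BoundedBy f → f u ≡ M → adj G w u ≡ true →
                   ReachKeeping f (update G f w)
  update-keeping {f} {w = w} bf fu≡M wu = step (w , λ _ → refl) (here λ _ → refl) , keep
    where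
      keep : ∀ x → f x ≡ M → update G f w x ≡ M
      keep x fx≡M with x ≟ w
      ... | yes refl = update-next-to-max bf fu≡M wu
      ... | no x≢w   = trans (update-≢ G f (λ w≡x → x≢w (sym w≡x))) fx≡M

  spread-path : ∀ {u w} → Path G u w → ∀ f → BoundedBy f → f u ≡ M →
                ∃ λ h → ReachKeeping f h × h w ≡ M
  spread-path stop f _ fu≡M = f , ReachKeeping-refl f , fu≡M
  spread-path (edge {u} {w′} uw′ p) f bf fu≡M
    with update-keeping bf fu≡M (adj-flip G uw′) | update-next-to-max bf fu≡M (adj-flip G uw′)
  ... | first@(r , _) | fw′≡M with spread-path p (update G f w′) (Reach-bounded r bf) fw′≡M
  ...   | h , rest , hw≡M = h , ReachKeeping-trans first rest , hw≡M

  spread-all : ∀ {v₀} → (∀ w → Path G v₀ w) → ∀ ws f → BoundedBy f → f v₀ ≡ M →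
               ∃ λ h → ReachKeeping f h × (∀ w → w ∈ ws → h w ≡ M)
  spread-all paths [] f _ _ = f , ReachKeeping-refl f , λ _ ()
  spread-all {v₀} paths (w ∷ ws) f bf fv₀≡M with spread-path (paths w) f bf fv₀≡M
  ... | g , first@(r , keep) , gw≡M
    with spread-all paths ws g (Reach-bounded r bf) (keep v₀ fv₀≡M)
  ...   | h , rest@(_ , keep′) , hws≡M =
    h , ReachKeeping-trans first rest ,
    λ { x (here refl) → keep′ x gw≡M ; x (there x∈ws) → hws≡M x x∈ws }

mainTheorem5 : (n : ℕ) (G : SimpleGraph n) → Connected G →
    (C : Valuation n → Set) → AbsorbingComponent G C →
    Σ (Valuation n) λ g → IsConstant g × ((h : Valuation n) → C h → h ≈ g) × ((h : Valuation n) → h ≈ g → C h)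
mainTheorem5 zero G _ C A with AbsorbingComponent.nonempty A
... | f , Cf = f , (λ ()) , (λ _ _ ()) , λ _ _ → AbsorbingComponent-≈ A Cf λ ()
mainTheorem5 (suc k) G connected C A with AbsorbingComponent.nonempty A
... | f , Cf with argmax f Fin.zero (allFin (suc k))
...   | v₀ , f≤fv₀ with Spread.spread-all G (f v₀) (connected v₀) (allFin (suc k)) f
                                     (λ x → f≤fv₀ (∈-allFin x)) refl
...     | g , (f⇝g , _) , g≡top =
  top , (λ _ _ → refl) ,
  (λ h Ch x → trans (Reach-constant G g-constant (AbsorbingComponent.strongly A g h Cg Ch) x v₀) (g≈top v₀)) ,
  (λ h h≈top → AbsorbingComponent-≈ A Cg λ x → trans (g≈top x) (sym (h≈top x)))
  where
    top : Valuation (suc k)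
    top _ = f v₀
    g≈top : g ≈ top
    g≈top x = g≡top x (∈-allFin x)
    g-constant : IsConstant g
    g-constant x y = trans (g≈top x) (sym (g≈top y))
    Cg : C g
    Cg = AbsorbingComponent-reach A Cf f⇝g
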